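{- The equation $x+y=z$ with $x,y,z\in\mathcal{B}_2$ has exactly one solution, namely $$x=y=\tfrac{\sqrt{3}-1}{2}=[\overline{2,1}],\qquad z=\sqrt{3}-1=[\overline{1,2}].$$
   Context: Every irrational $x\in(0,1)$ has a simple continued fraction expansion $x=[a_1,a_2,\dots]=\cfrac{1}{a_1+\cfrac{1}{a_2+\cdots}}$ with positive integers $a_k$; an overline denotes a periodically repeated block. $\mathcal{B}_2$ is the set of irrational $x\in(0,1)$ with $a_k\le2$ for all $k$. -}

module Defs where

open import Data.Nat using (ℕ; zero; suc; _+_; _*_; _∸_; _%_; _≤_; _<_; ∣_-_∣)
open import Data.Product using (_×_; _,_; proj₁; proj₂; ∃-syntax)

-- An infinite simple continued fraction x = [a₁, a₂, …] is represented by the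
-- sequence a : ℕ → ℕ with a k = a_{k+1} (0-based index).

-- x ∈ 𝓑₂ : all partial quotients satisfy 1 ≤ a_k ≤ 2.
-- (Infinite expansions with positive partial quotients are exactly the irrationals in (0,1).)
B₂ : (ℕ → ℕ) → Set
B₂ a = ∀ k → 1 ≤ a k × a k ≤ 2

-- n-th convergent [a₁,…,aₙ] = 1/(a₁ + 1/(a₂ + … + 1/aₙ)) as a pair (numerator , denominator),
-- computed from the inside out: [ ] = 0/1 and [a₁, rest] = 1/(a₁ + p/q) = q/(a₁ q + p).
conv : (ℕ → ℕ) → ℕ → ℕ × ℕ
conv a zero = 0 , 1
conv a (suc n) with conv (λ k → a (suc k)) n
... | p , q = q , a 0 * q + p

num den : (ℕ → ℕ) → ℕ → ℕ
num a n = proj₁ (conv a n)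
den a n = proj₂ (conv a n)

-- The real numbers x = [a], y = [b], z = [c] satisfy x + y = z, i.e. the convergent
-- sequences satisfy  conv_n(a) + conv_n(b) - conv_n(c) → 0 :
-- for every m there is N with, for all n ≥ N,
--   | pa/qa + pb/qb - pc/qc | < 1/(m+1),
-- written with denominators cleared (all quantities are natural numbers).
SumEq : (ℕ → ℕ) → (ℕ → ℕ) → (ℕ → ℕ) → Set
SumEq a b c =
  ∀ m → ∃[ N ] ∀ n → N ≤ n →
    suc m * ∣ (num a n * den b n + num b n * den a n) * den c n
            - num c n * (den a n * den b n) ∣
      < den a n * den b n * den c n

per21 : ℕ → ℕ
per21 k = 2 ∸ (k % 2)

per12 : ℕ → ℕ
per12 k = 1 + (k % 2)

-- The continued fractions α = [‾2,1‾] and β = [‾1,2‾] are the smallest and the largest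
-- element of 𝓑₂, and β = 2α. Hence x + y − z ≥ α + α − β = 0 on 𝓑₂, with equality only
-- if x = y = α and z = β. Everything is done on convergents: the n-th convergent of α is
-- the least, and that of β the largest, among n-th convergents of elements of 𝓑₂, and
-- their identity β = 2α already holds convergent by convergent. If x differs from α first
-- in the partial quotient with index k, then from the convergent n > k on the gap is at
-- least 1/9^(k+1): prepending a partial quotient c ≤ 2 maps t ↦ 1/(c + t), which shrinks
-- distances in [0,1] by at most a factor 9. Such a uniform gap contradicts convergence.
module Submission where

open import Defs
open import Data.Nat using (ℕ)
open import Data.Product using (_×_)
open import Function.Bundles using (_⇔_)
open import Relation.Binary.PropositionalEquality using (_≡_)

open import Data.Nat using (suc; _+_; _*_; _∸_; _^_; _≤_; _<_; _≟_; ∣_-_∣; z≤n; s≤s; >-nonZero)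
open import Data.Nat.Properties
open import Data.Nat.Tactic.RingSolver using (solve)
open import Data.List using (_∷_; [])
open import Data.Product using (_,_; proj₁; proj₂)
open import Function.Bundles using (mk⇔)
open import Relation.Nullary using (¬_)
open import Relation.Nullary.Decidable using (decidable-stable)
open import Relation.Binary.PropositionalEquality using (_≢_; refl; sym; trans; cong; cong₂; subst; subst₂)
open ≤-Reasoning

Fraction : Set
Fraction = ℕ × ℕ

shift : (ℕ → ℕ) → ℕ → ℕ
shift a k = a (suc k)

-- prepend c t = 1/(c + t), so that conv a (suc n) = prepend (a 0) (conv (shift a) n)
prepend : ℕ → Fraction → Fraction
prepend c (p , q) = q , c * q + p

_⊕_ : Fraction → Fraction → Fraction
(p , q) ⊕ (r , s) = p * s + r * q , q * s

double : Fraction → Fraction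
double (p , q) = 2 * p , q

infixl 6 _⊕_
infix 4 _≃_ _≼_ _≼⟨_/_⟩_

AtMostOne : Fraction → Set
AtMostOne (p , q) = p ≤ q

_≃_ : Fraction → Fraction → Set
(p , q) ≃ (r , s) = p * s ≡ r * q

_≼_ : Fraction → Fraction → Set
(p , q) ≼ (r , s) = p * s ≤ r * q

-- x ≼⟨ e / M ⟩ y  means  x + e/M ≤ y
_≼⟨_/_⟩_ : Fraction → ℕ → ℕ → Fraction → Set
(p , q) ≼⟨ e / M ⟩ (r , s) = M * (p * s) + e * (q * s) ≤ M * (r * q)

-- Close m x y  means  |x − y| < 1/(m+1); SumEq a b c unfolds to eventual closeness.
Close : ℕ → Fraction → Fraction → Set
Close m (p , q) (r , s) = suc m * ∣ p * s - r * q ∣ < q * s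

≼⇒≼⟨0/⟩ : ∀ {x y M} → x ≼ y → x ≼⟨ 0 / M ⟩ y
≼⇒≼⟨0/⟩ {p , q} {r , s} {M} x≼y = begin
  M * (p * s) + 0 ≡⟨ +-identityʳ _ ⟩
  M * (p * s)     ≤⟨ *-monoʳ-≤ M x≼y ⟩
  M * (r * q)     ∎

≃⇒Close : ∀ {x y} m → 1 ≤ proj₂ x → 1 ≤ proj₂ y → x ≃ y → Close m x y
≃⇒Close {p , q} {r , s} m q≥1 s≥1 x≃y = begin-strict
  suc m * ∣ p * s - r * q ∣ ≡⟨ cong (suc m *_) (m≡n⇒∣m-n∣≡0 x≃y) ⟩
  suc m * 0                 ≡⟨ *-zeroʳ (suc m) ⟩
  0                         <⟨ *-mono-≤ q≥1 s≥1 ⟩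
  q * s                     ∎

≼⟨1/⟩⇒¬Close : ∀ {z w M} → z ≼⟨ 1 / M ⟩ w → ¬ Close M w z
≼⟨1/⟩⇒¬Close {T , U} {W , V} {M} gap close = <⇒≱ close (begin
  V * U                      ≡⟨ solve (U ∷ V ∷ []) ⟩
  1 * (U * V)                ≤⟨ m+n≤o⇒m≤o∸n _ (≤-trans (≤-reflexive (+-comm _ (M * (T * V)))) gap) ⟩
  M * (W * U) ∸ M * (T * V)  ≡⟨ sym (*-distribˡ-∸ M (W * U) (T * V)) ⟩
  M * (W * U ∸ T * V)        ≤⟨ *-monoʳ-≤ M (m∸n≤∣m-n∣ (W * U) (T * V)) ⟩
  M * ∣ W * U - T * V ∣      ≤⟨ *-monoˡ-≤ _ (n≤1+n M) ⟩
  suc M * ∣ W * U - T * V ∣  ∎)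

prepend-antitone : ∀ {c c' x y} → c ≤ c' → x ≼ y → prepend c' y ≼ prepend c x
prepend-antitone {c} {c'} {p , q} {r , s} c≤c' x≼y = begin
  s * (c * q + p)       ≡⟨ solve (c ∷ p ∷ q ∷ s ∷ []) ⟩
  c * (q * s) + p * s   ≤⟨ +-mono-≤ (*-monoˡ-≤ (q * s) c≤c') x≼y ⟩
  c' * (q * s) + r * q  ≡⟨ solve (c' ∷ q ∷ r ∷ s ∷ []) ⟩
  q * (c' * s + r)      ∎

-- Raising the partial quotient by d gains d/9 and a gap e/M shrinks at most to e/(9M):
-- 1/(c + t) − 1/(c' + u) = (c' − c + u − t)/((c + t)(c' + u)), and for partial quotients
-- at most 2 and t, u ≤ 1 the denominator is at most 9.
prepend-margin : ∀ {c c' d e M x y} → d + c ≤ c' → c' ≤ 2 → AtMostOne x → AtMostOne y →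
                 x ≼⟨ e / M ⟩ y → prepend c' y ≼⟨ d * M + e / 9 * M ⟩ prepend c x
prepend-margin {c} {c'} {d} {e} {M} {p , q} {r , s} d+c≤c' c'≤2 p≤q r≤s gap = begin
  9 * M * (s * (c * q + p)) + (d * M + e) * ((c' * s + r) * (c * q + p))
    ≤⟨ +-monoʳ-≤ (9 * M * (s * (c * q + p))) (*-monoʳ-≤ (d * M + e) den-product-≤) ⟩
  9 * M * (s * (c * q + p)) + (d * M + e) * (9 * (q * s))
    ≡⟨ solve (c ∷ d ∷ e ∷ M ∷ p ∷ q ∷ s ∷ []) ⟩
  9 * (M * (d + c) * (q * s)) + 9 * (M * (p * s) + e * (q * s))
    ≤⟨ +-mono-≤ (*-monoʳ-≤ 9 (*-monoˡ-≤ (q * s) (*-monoʳ-≤ M d+c≤c'))) (*-monoʳ-≤ 9 gap) ⟩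
  9 * (M * c' * (q * s)) + 9 * (M * (r * q))
    ≡⟨ solve (c' ∷ M ∷ q ∷ r ∷ s ∷ []) ⟩
  9 * M * (q * (c' * s + r)) ∎
  where
  c≤2 : c ≤ 2
  c≤2 = ≤-trans (m≤n+m c d) (≤-trans d+c≤c' c'≤2)
  den-product-≤ : (c' * s + r) * (c * q + p) ≤ 9 * (q * s)
  den-product-≤ = begin
    (c' * s + r) * (c * q + p) ≤⟨ *-mono-≤ (+-mono-≤ (*-monoˡ-≤ s c'≤2) r≤s) (+-mono-≤ (*-monoˡ-≤ q c≤2) p≤q) ⟩
    (2 * s + s) * (2 * q + q)  ≡⟨ solve (q ∷ s ∷ []) ⟩
    9 * (q * s)                ∎

prepend-double : ∀ {x y} → y ≃ double x → prepend 1 x ≃ double (prepend 2 y)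
prepend-double {p , q} {r , s} y≃2x = begin-equality
  q * (2 * s + r)          ≡⟨ solve (q ∷ r ∷ s ∷ []) ⟩
  2 * (q * s) + r * q      ≡⟨ cong (2 * (q * s) +_) y≃2x ⟩
  2 * (q * s) + 2 * p * s  ≡⟨ solve (p ∷ q ∷ s ∷ []) ⟩
  2 * s * (1 * q + p)      ∎

≃double⇒⊕-self≃ : ∀ {x y} → y ≃ double x → x ⊕ x ≃ y
≃double⇒⊕-self≃ {p , q} {r , s} y≃2x = begin-equality
  (p * q + p * q) * s ≡⟨ solve (p ∷ q ∷ s ∷ []) ⟩
  q * (2 * p * s)     ≡⟨ cong (q *_) (sym y≃2x) ⟩
  q * (r * q)         ≡⟨ solve (q ∷ r ∷ []) ⟩
  r * (q * q)         ∎

-- Margins add up: x + y − z ≥ (x − α) + (y − α) + (β − z) once β = 2α.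
⊕-margin : ∀ {α β x y z e₁ e₂ e₃ M} → 1 ≤ proj₂ α → 1 ≤ proj₂ β → β ≃ double α →
           α ≼⟨ e₁ / M ⟩ x → α ≼⟨ e₂ / M ⟩ y → z ≼⟨ e₃ / M ⟩ β →
           z ≼⟨ e₁ + e₂ + e₃ / M ⟩ (x ⊕ y)
⊕-margin {p , q} {r , s} {P , Q} {R , S} {T , U} {e₁} {e₂} {e₃} {M} q≥1 s≥1 β≃2α gx gy gz =
  *-cancelʳ-≤ _ _ (q * s) {{>-nonZero (*-mono-≤ q≥1 s≥1)}} (begin
    (M * (T * (Q * S)) + (e₁ + e₂ + e₃) * (U * (Q * S))) * (q * s)
      ≡⟨ solve (e₁ ∷ e₂ ∷ e₃ ∷ M ∷ q ∷ s ∷ Q ∷ S ∷ T ∷ U ∷ []) ⟩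
    M * (T * (Q * S)) * (q * s) + e₃ * (U * (Q * S)) * (q * s) + (e₁ + e₂) * (U * (Q * S)) * (q * s)
      ≤⟨ +-monoˡ-≤ _ z+e₃≤2α ⟩
    M * (Q * S * U) * (2 * p * s) + (e₁ + e₂) * (U * (Q * S)) * (q * s)
      ≤⟨ 2α+e₁+e₂≤x+y ⟩
    M * ((P * S + R * Q) * U) * (q * s) ∎)
  where
  z+e₃≤2α : M * (T * (Q * S)) * (q * s) + e₃ * (U * (Q * S)) * (q * s) ≤ M * (Q * S * U) * (2 * p * s)
  z+e₃≤2α = begin
    M * (T * (Q * S)) * (q * s) + e₃ * (U * (Q * S)) * (q * s)
      ≡⟨ solve (e₃ ∷ M ∷ q ∷ s ∷ Q ∷ S ∷ T ∷ U ∷ []) ⟩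
    (M * (T * s) + e₃ * (U * s)) * (Q * S * q) ≤⟨ *-monoˡ-≤ (Q * S * q) gz ⟩
    M * (r * U) * (Q * S * q)                  ≡⟨ solve (M ∷ q ∷ r ∷ Q ∷ S ∷ U ∷ []) ⟩
    M * (Q * S * U) * (r * q)                  ≡⟨ cong (M * (Q * S * U) *_) β≃2α ⟩
    M * (Q * S * U) * (2 * p * s)              ∎
  2α+e₁+e₂≤x+y : M * (Q * S * U) * (2 * p * s) + (e₁ + e₂) * (U * (Q * S)) * (q * s)
                 ≤ M * ((P * S + R * Q) * U) * (q * s)
  2α+e₁+e₂≤x+y = begin
    M * (Q * S * U) * (2 * p * s) + (e₁ + e₂) * (U * (Q * S)) * (q * s)
      ≡⟨ solve (e₁ ∷ e₂ ∷ M ∷ p ∷ q ∷ s ∷ Q ∷ S ∷ U ∷ []) ⟩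
    (M * (p * Q) + e₁ * (q * Q)) * (S * U * s) + (M * (p * S) + e₂ * (q * S)) * (Q * U * s)
      ≤⟨ +-mono-≤ (*-monoˡ-≤ (S * U * s) gx) (*-monoˡ-≤ (Q * U * s) gy) ⟩
    M * (P * q) * (S * U * s) + M * (R * q) * (Q * U * s)
      ≡⟨ solve (M ∷ q ∷ s ∷ P ∷ Q ∷ R ∷ S ∷ U ∷ []) ⟩
    M * ((P * S + R * Q) * U) * (q * s) ∎

conv-cong : ∀ {a b} → (∀ k → a k ≡ b k) → ∀ n → conv a n ≡ conv b n
conv-cong a≗b 0       = refl
conv-cong a≗b (suc n) = cong₂ prepend (a≗b 0) (conv-cong (λ k → a≗b (suc k)) n)

num≤den : ∀ {a} → (∀ k → 1 ≤ a k) → ∀ n → AtMostOne (conv a n)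
num≤den a≥1 0       = z≤n
num≤den {a} a≥1 (suc n) = begin
  q                         ≤⟨ m≤n*m q (a 0) {{>-nonZero (a≥1 0)}} ⟩
  a 0 * q                   ≤⟨ m≤m+n (a 0 * q) _ ⟩
  a 0 * q + num (shift a) n ∎
  where q = den (shift a) n

den≥1 : ∀ {a} → (∀ k → 1 ≤ a k) → ∀ n → 1 ≤ den a n
den≥1 a≥1 0       = s≤s z≤n
den≥1 a≥1 (suc n) = ≤-trans (den≥1 (λ k → a≥1 (suc k)) n) (num≤den a≥1 (suc n))

per21-shift : ∀ k → per21 (suc k) ≡ per12 k
per21-shift 0             = refl
per21-shift 1             = refl
per21-shift (suc (suc k)) = per21-shift k

per12-shift : ∀ k → per12 (suc k) ≡ per21 k
per12-shift 0             = refl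
per12-shift 1             = refl
per12-shift (suc (suc k)) = per12-shift k

per21≥1 : ∀ k → 1 ≤ per21 k
per21≥1 0             = s≤s z≤n
per21≥1 1             = s≤s z≤n
per21≥1 (suc (suc k)) = per21≥1 k

per12≥1 : ∀ k → 1 ≤ per12 k
per12≥1 k = s≤s z≤n

conv-per21-suc : ∀ n → conv per21 (suc n) ≡ prepend 2 (conv per12 n)
conv-per21-suc n = cong (prepend 2) (conv-cong per21-shift n)

conv-per12-suc : ∀ n → conv per12 (suc n) ≡ prepend 1 (conv per21 n)
conv-per12-suc n = cong (prepend 1) (conv-cong per12-shift n)

conv-per12≃double : ∀ n → conv per12 n ≃ double (conv per21 n)
conv-per12≃double 0 = refl
conv-per12≃double (suc n) =
  subst₂ (λ u v → u ≃ double v) (sym (conv-per12-suc n)) (sym (conv-per21-suc n))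
    (prepend-double {conv per21 n} {conv per12 n} (conv-per12≃double n))

B₂-shift : ∀ {a} → B₂ a → B₂ (shift a)
B₂-shift Ba k = Ba (suc k)

B₂⇒≥1 : ∀ {a} → B₂ a → ∀ k → 1 ≤ a k
B₂⇒≥1 Ba k = proj₁ (Ba k)

per21-≼-conv : ∀ {a} → B₂ a → ∀ n → conv per21 n ≼ conv a n
conv-≼-per12 : ∀ {a} → B₂ a → ∀ n → conv a n ≼ conv per12 n

per21-≼-conv Ba 0 = z≤n
per21-≼-conv {a} Ba (suc n) =
  subst (_≼ conv a (suc n)) (sym (conv-per21-suc n))
    (prepend-antitone {x = conv (shift a) n} {conv per12 n}
      (proj₂ (Ba 0)) (conv-≼-per12 {shift a} (B₂-shift Ba) n))

conv-≼-per12 Ba 0 = z≤n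
conv-≼-per12 {a} Ba (suc n) =
  subst (conv a (suc n) ≼_) (sym (conv-per12-suc n))
    (prepend-antitone {x = conv per21 n} {conv (shift a) n}
      (proj₁ (Ba 0)) (per21-≼-conv {shift a} (B₂-shift Ba) n))

-- The extremal sequences swap under shift, so the first disagreement with one of them
-- at index k + 1 is a first disagreement with the other at index k.
per21-margin-conv : ∀ {a k n} → B₂ a → a k ≢ per21 k → k < n →
                    conv per21 n ≼⟨ 1 / 9 ^ suc k ⟩ conv a n
conv-margin-per12 : ∀ {a k n} → B₂ a → a k ≢ per12 k → k < n →
                    conv a n ≼⟨ 1 / 9 ^ suc k ⟩ conv per12 n

per21-margin-conv {a} {0} {suc n} Ba a₀≢2 _ =
  subst (λ u → u ≼⟨ 1 / 9 ⟩ conv a (suc n)) (sym (conv-per21-suc n))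
    (prepend-margin {a 0} {2} {1} {0} {1} {conv (shift a) n} {conv per12 n}
      (≤∧≢⇒< (proj₂ (Ba 0)) a₀≢2) ≤-refl
      (num≤den {shift a} (B₂⇒≥1 (B₂-shift Ba)) n) (num≤den per12≥1 n)
      (≼⇒≼⟨0/⟩ {conv (shift a) n} {conv per12 n} {1} (conv-≼-per12 {shift a} (B₂-shift Ba) n)))
per21-margin-conv {a} {suc k} {suc n} Ba aₖ≢ (s≤s k<n) =
  subst (λ u → u ≼⟨ 1 / 9 ^ suc (suc k) ⟩ conv a (suc n)) (sym (conv-per21-suc n))
    (prepend-margin {a 0} {2} {0} {1} {9 ^ suc k} {conv (shift a) n} {conv per12 n}
      (proj₂ (Ba 0)) ≤-refl
      (num≤den {shift a} (B₂⇒≥1 (B₂-shift Ba)) n) (num≤den per12≥1 n)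
      (conv-margin-per12 {shift a} (B₂-shift Ba) (λ e → aₖ≢ (trans e (sym (per21-shift k)))) k<n))

conv-margin-per12 {a} {0} {suc n} Ba a₀≢1 _ =
  subst (λ u → conv a (suc n) ≼⟨ 1 / 9 ⟩ u) (sym (conv-per12-suc n))
    (prepend-margin {1} {a 0} {1} {0} {1} {conv per21 n} {conv (shift a) n}
      (≤∧≢⇒< (proj₁ (Ba 0)) (λ e → a₀≢1 (sym e))) (proj₂ (Ba 0))
      (num≤den per21≥1 n) (num≤den {shift a} (B₂⇒≥1 (B₂-shift Ba)) n)
      (≼⇒≼⟨0/⟩ {conv per21 n} {conv (shift a) n} {1} (per21-≼-conv {shift a} (B₂-shift Ba) n)))
conv-margin-per12 {a} {suc k} {suc n} Ba aₖ≢ (s≤s k<n) =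
  subst (λ u → conv a (suc n) ≼⟨ 1 / 9 ^ suc (suc k) ⟩ u) (sym (conv-per12-suc n))
    (prepend-margin {1} {a 0} {0} {1} {9 ^ suc k} {conv per21 n} {conv (shift a) n}
      (proj₁ (Ba 0)) (proj₂ (Ba 0))
      (num≤den per21≥1 n) (num≤den {shift a} (B₂⇒≥1 (B₂-shift Ba)) n)
      (per21-margin-conv {shift a} (B₂-shift Ba) (λ e → aₖ≢ (trans e (sym (per12-shift k)))) k<n))

per21-≼⟨0/⟩-conv : ∀ {a} M → B₂ a → ∀ n → conv per21 n ≼⟨ 0 / M ⟩ conv a n
per21-≼⟨0/⟩-conv {a} M Ba n = ≼⇒≼⟨0/⟩ {conv per21 n} {conv a n} {M} (per21-≼-conv Ba n)

conv-≼⟨0/⟩-per12 : ∀ {a} M → B₂ a → ∀ n → conv a n ≼⟨ 0 / M ⟩ conv per12 n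
conv-≼⟨0/⟩-per12 {a} M Ba n = ≼⇒≼⟨0/⟩ {conv a n} {conv per12 n} {M} (conv-≼-per12 Ba n)

conv-⊕-margin : ∀ {a b c} e₁ e₂ e₃ M n →
                conv per21 n ≼⟨ e₁ / M ⟩ conv a n → conv per21 n ≼⟨ e₂ / M ⟩ conv b n →
                conv c n ≼⟨ e₃ / M ⟩ conv per12 n → conv c n ≼⟨ e₁ + e₂ + e₃ / M ⟩ (conv a n ⊕ conv b n)
conv-⊕-margin {a} {b} {c} e₁ e₂ e₃ M n =
  ⊕-margin {conv per21 n} {conv per12 n} {conv a n} {conv b n} {conv c n} {e₁} {e₂} {e₃} {M}
    (den≥1 per21≥1 n) (den≥1 per12≥1 n) (conv-per12≃double n)

margin⇒¬SumEq : ∀ {a b c} k M → (∀ n → k < n → conv c n ≼⟨ 1 / M ⟩ (conv a n ⊕ conv b n)) →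
                ¬ SumEq a b c
margin⇒¬SumEq {a} {b} {c} k M margin sum =
  ≼⟨1/⟩⇒¬Close {conv c n} {conv a n ⊕ conv b n} {M}
    (margin n (m≤n+m (suc k) N)) (close n (m≤m+n N (suc k)))
  where
  N = proj₁ (sum M)
  close = proj₂ (sum M)
  n = N + suc k

SumEq-cong : ∀ {a a' b b' c c'} → (∀ k → a k ≡ a' k) → (∀ k → b k ≡ b' k) → (∀ k → c k ≡ c' k) →
             SumEq a' b' c' → SumEq a b c
SumEq-cong {a} {a'} {b} {b'} {c} {c'} a≗ b≗ c≗ sum m =
  proj₁ (sum m) , λ n N≤n → transport n (proj₂ (sum m) n N≤n)
  where
  transport : ∀ n → Close m (conv a' n ⊕ conv b' n) (conv c' n) →
                    Close m (conv a n ⊕ conv b n) (conv c n)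
  transport n rewrite conv-cong a≗ n | conv-cong b≗ n | conv-cong c≗ n = λ close → close

SumEq-per21-per21-per12 : SumEq per21 per21 per12
SumEq-per21-per21-per12 m = 0 , λ n _ →
  ≃⇒Close {conv per21 n ⊕ conv per21 n} {conv per12 n} m
    (*-mono-≤ (den≥1 per21≥1 n) (den≥1 per21≥1 n)) (den≥1 per12≥1 n)
    (≃double⇒⊕-self≃ {conv per21 n} {conv per12 n} (conv-per12≃double n))

lemma5p2 : (a b c : ℕ → ℕ) → B₂ a → B₂ b → B₂ c →
           SumEq a b c ⇔ ((∀ k → a k ≡ per21 k) × (∀ k → b k ≡ per21 k) × (∀ k → c k ≡ per12 k))
lemma5p2 a b c Ba Bb Bc = mk⇔ digits-forced (λ (a≗ , b≗ , c≗) → SumEq-cong a≗ b≗ c≗ SumEq-per21-per21-per12)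
  where
  M : ℕ → ℕ
  M k = 9 ^ suc k

  digits-forced : SumEq a b c → (∀ k → a k ≡ per21 k) × (∀ k → b k ≡ per21 k) × (∀ k → c k ≡ per12 k)
  digits-forced sum =
      (λ k → decidable-stable (a k ≟ per21 k) λ aₖ≢ → margin⇒¬SumEq k (M k) (λ n k<n →
        conv-⊕-margin 1 0 0 (M k) n (per21-margin-conv Ba aₖ≢ k<n)
          (per21-≼⟨0/⟩-conv (M k) Bb n) (conv-≼⟨0/⟩-per12 (M k) Bc n)) sum)
    , (λ k → decidable-stable (b k ≟ per21 k) λ bₖ≢ → margin⇒¬SumEq k (M k) (λ n k<n →
        conv-⊕-margin 0 1 0 (M k) n (per21-≼⟨0/⟩-conv (M k) Ba n)
          (per21-margin-conv Bb bₖ≢ k<n) (conv-≼⟨0/⟩-per12 (M k) Bc n)) sum)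
    , (λ k → decidable-stable (c k ≟ per12 k) λ cₖ≢ → margin⇒¬SumEq k (M k) (λ n k<n →
        conv-⊕-margin 0 0 1 (M k) n (per21-≼⟨0/⟩-conv (M k) Ba n)
          (per21-≼⟨0/⟩-conv (M k) Bb n) (conv-margin-per12 Bc cₖ≢ k<n)) sum)
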